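{- An $(m,n)$-mixed graph $G$ is an $(m,n)$-mixed simple clique (i.e. $\chi_s(G)=|V(G)|$) if and only if $\mathrm{conv}(\{u,v\}) = V(G)$ for all distinct $u,v\in V(G)$.
   Context: An $(m,n)$-mixed graph $G=(V,A,E)$ is a simple graph (no loops, at most one adjacency between any pair of vertices) in which each adjacency is either an arc or an edge, with colour functions $c_A: A \to \{1,\dots,m\}$, $c_E: E \to \{1,\dots,n\}$. A simple homomorphism $\phi: G\to_s H$ is a map $V(G)\to V(H)$ such that either $|V(G)|=1$, or $\phi$ is non-constant and every adjacency $uv$ with $\phi(u)\neq\phi(v)$ is mapped to an adjacency of the same type (edge/arc, same direction, same colour); $\chi_s(G)$ is the least number of vertices of an $H$ with $G\to_s H$. If $uv, wv$ are adjacencies of $G$, then $u$ and $w$ agree on $v$ if $uv, wv$ are both edges of the same colour, or both arcs towards $v$ of the same colour, or both arcs from $v$ of the same colour; otherwise $v$ is between $u$ and $w$. A set $C\subseteq V(G)$ is convex if for all $u,w\in C$ no $v\in V(G)\setminus C$ is between $u$ and $w$; $\mathrm{conv}(N)$ is the smallest convex set containing $N$. -}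

module Defs where

open import Data.Nat using (ℕ; suc; _≤_)
open import Data.Fin using (Fin)
open import Data.Fin.Subset using (Subset; _∈_; _∉_; ⁅_⁆; _∪_; _⊆_)
open import Data.Product using (Σ; _×_; ∃-syntax)
open import Data.Sum using (_⊎_)
open import Relation.Binary.PropositionalEquality using (_≡_; _≢_)
open import Relation.Nullary using (¬_)

-- The adjacency between an ordered pair (u , v), seen from u:
--   none      : u and v are not adjacent
--   edge c    : uv is an edge of colour c
--   arcOut c  : uv is an arc u → v of colour c
--   arcIn c   : uv is an arc v → u of colour c
-- Colours 1..m (resp. 1..n) are represented by Fin m (resp. Fin n).
data Adj (m n : ℕ) : Set where
  none   : Adj m n
  edge   : Fin n → Adj m n
  arcOut : Fin m → Adj m n
  arcIn  : Fin m → Adj m n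

rev : ∀ {m n} → Adj m n → Adj m n
rev none       = none
rev (edge c)   = edge c
rev (arcOut c) = arcIn c
rev (arcIn c)  = arcOut c

-- A finite (m,n)-mixed graph on vertex set Fin size: no loops, and
-- at most one adjacency per pair (encoded by a single Adj value,
-- consistently seen from both endpoints).
record MixedGraph (m n : ℕ) : Set where
  field
    size   : ℕ
    adj    : Fin size → Fin size → Adj m n
    loopless  : ∀ u → adj u u ≡ none
    adj-sym   : ∀ u v → adj v u ≡ rev (adj u v)

open MixedGraph public

IsSimpleHom : ∀ {m n} (G H : MixedGraph m n) → (Fin (size G) → Fin (size H)) → Set
IsSimpleHom G H φ =
  (size G ≡ 1)
  ⊎ ((∃[ u ] ∃[ v ] (φ u ≢ φ v))
      × (∀ u v → adj G u v ≢ none → φ u ≢ φ v → adj H (φ u) (φ v) ≡ adj G u v))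

_→s_ : ∀ {m n} (G H : MixedGraph m n) → Set
G →s H = Σ (Fin (size G) → Fin (size H)) (IsSimpleHom G H)

IsChiS : ∀ {m n} (G : MixedGraph m n) → ℕ → Set
IsChiS {m} {n} G c =
  (Σ (MixedGraph m n) λ H → (size H ≡ c) × (G →s H))
  × (∀ (H : MixedGraph m n) → G →s H → c ≤ size H)

IsSimpleClique : ∀ {m n} (G : MixedGraph m n) → Set
IsSimpleClique G = IsChiS G (size G)

Between : ∀ {m n} (G : MixedGraph m n) (u w v : Fin (size G)) → Set
Between G u w v =
  adj G u v ≢ none × adj G w v ≢ none × adj G u v ≢ adj G w v

IsConvex : ∀ {m n} (G : MixedGraph m n) → Subset (size G) → Set
IsConvex G C = ∀ u w v → u ∈ C → w ∈ C → v ∉ C → ¬ Between G u w v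

_∈conv_ : ∀ {m n} {G : MixedGraph m n} → Fin (size G) → Subset (size G) → Set
_∈conv_ {G = G} x N = ∀ (C : Subset (size G)) → IsConvex G C → N ⊆ C → x ∈ C

ConvPairFull : ∀ {m n} (G : MixedGraph m n) (u v : Fin (size G)) → Set
ConvPairFull G u v = ∀ x → _∈conv_ {G = G} x (⁅ u ⁆ ∪ ⁅ v ⁆)

{-# OPTIONS --safe #-}
-- If conv({u,v}) = V for all u ≠ v, the fibre of a simple homomorphism is convex (two
-- vertices with the same image see any vertex outside the fibre alike), so a fibre
-- containing two vertices is everything and the map would be constant: simple
-- homomorphisms are injective. Conversely, a convex C ∌ x containing u ≠ v can be
-- contracted onto u; convexity makes all of C see each outside vertex alike, so this is
-- a simple homomorphism missing v, and deleting v gives a target with fewer vertices.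
module Submission where

open import Defs
open import Data.Nat using (ℕ; NonZero; zero; suc; _≤_)
open import Data.Nat.Properties using (<-irrefl)
open import Data.Fin using (Fin; zero; suc; punchIn; punchOut; _≟_)
open import Data.Fin.Properties using (any?; punchIn-injective; punchIn-punchOut; injective⇒≤)
open import Data.Fin.Subset using (Subset; _∈_; _∉_; ⁅_⁆; _∪_; _⊆_)
open import Data.Fin.Subset.Properties using (_∈?_; x∈⁅x⁆; x∈p∪q⁺; x∈p∪q⁻; x∈⁅y⁆⇒x≡y)
open import Data.Vec using (tabulate)
open import Data.Vec.Properties using (lookup∘tabulate; []=⇒lookup; lookup⇒[]=)
open import Data.Product using (Σ-syntax; _×_; _,_)
open import Data.Sum using (_⊎_; inj₁; inj₂)
open import Data.Empty using (⊥-elim)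
open import Function.Definitions using (Injective)
open import Relation.Nullary using (¬_; yes; no; does; ¬?)
open import Relation.Nullary.Decidable using (_×-dec_; dec-true; map′)
open import Relation.Binary.Definitions using (DecidableEquality)
open import Relation.Binary.PropositionalEquality

private variable m n : ℕ

_≟ᴬ_ : DecidableEquality (Adj m n)
none     ≟ᴬ none     = yes refl
edge c   ≟ᴬ edge d   = map′ (cong edge) (λ { refl → refl }) (c ≟ d)
arcOut c ≟ᴬ arcOut d = map′ (cong arcOut) (λ { refl → refl }) (c ≟ d)
arcIn c  ≟ᴬ arcIn d  = map′ (cong arcIn) (λ { refl → refl }) (c ≟ d)
none     ≟ᴬ edge _   = no λ ()
none     ≟ᴬ arcOut _ = no λ ()
none     ≟ᴬ arcIn _  = no λ ()
edge _   ≟ᴬ none     = no λ ()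
edge _   ≟ᴬ arcOut _ = no λ ()
edge _   ≟ᴬ arcIn _  = no λ ()
arcOut _ ≟ᴬ none     = no λ ()
arcOut _ ≟ᴬ edge _   = no λ ()
arcOut _ ≟ᴬ arcIn _  = no λ ()
arcIn _  ≟ᴬ none     = no λ ()
arcIn _  ≟ᴬ edge _   = no λ ()
arcIn _  ≟ᴬ arcOut _ = no λ ()

rev-involutive : (a : Adj m n) → rev (rev a) ≡ a
rev-involutive none       = refl
rev-involutive (edge _)   = refl
rev-involutive (arcOut _) = refl
rev-involutive (arcIn _)  = refl

rev-≢none : (a : Adj m n) → a ≢ none → rev a ≢ none
rev-≢none none       a≢none = a≢none
rev-≢none (edge _)   _      = λ ()
rev-≢none (arcOut _) _      = λ ()
rev-≢none (arcIn _)  _      = λ ()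

module _ (G : MixedGraph m n) where

  adjacent-sym : ∀ a b → adj G a b ≢ none → adj G b a ≢ none
  adjacent-sym a b ab rewrite adj-sym G a b = rev-≢none (adj G a b) ab

  PreservesAdjacencies : (H : MixedGraph m n) → (Fin (size G) → Fin (size H)) → Set
  PreservesAdjacencies H φ =
    ∀ a b → adj G a b ≢ none → φ a ≢ φ b → adj H (φ a) (φ b) ≡ adj G a b

  convex⇒agree : ∀ {C u w v} → IsConvex G C → u ∈ C → w ∈ C → v ∉ C →
                 adj G u v ≢ none → adj G w v ≢ none → adj G u v ≡ adj G w v
  convex⇒agree {u = u} {w} {v} convex u∈C w∈C v∉C uv wv with adj G u v ≟ᴬ adj G w v
  ... | yes agree = agree
  ... | no between = ⊥-elim (convex _ _ _ u∈C w∈C v∉C (uv , wv , between))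

induced : (H : MixedGraph m n) {k : ℕ} → (Fin k → Fin (size H)) → MixedGraph m n
induced H {k} ι = record
  { size     = k
  ; adj      = λ i j → adj H (ι i) (ι j)
  ; loopless = λ i → loopless H (ι i)
  ; adj-sym  = λ i j → adj-sym H (ι i) (ι j)
  }

→s-corestrict : ∀ {G H : MixedGraph m n} {k φ} (ι : Fin k → Fin (size H)) →
                Injective _≡_ _≡_ ι → (ψ : Fin (size G) → Fin k) → (∀ y → ι (ψ y) ≡ φ y) →
                IsSimpleHom G H φ → IsSimpleHom G (induced H ι) ψ
→s-corestrict ι ι-inj ψ factors (inj₁ single) = inj₁ single
→s-corestrict {G = G} {H} {φ = φ} ι ι-inj ψ factors (inj₂ ((a , b , φa≢φb) , preserves)) =
  inj₂ ((a , b , λ e → φa≢φb (reflect e)) , preserves′)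
  where
  reflect : ∀ {u v} → ψ u ≡ ψ v → φ u ≡ φ v
  reflect {u} {v} e = trans (sym (factors u)) (trans (cong ι e) (factors v))

  preserves′ : PreservesAdjacencies G (induced H ι) ψ
  preserves′ u v uv ψu≢ψv rewrite factors u | factors v =
    preserves u v uv λ e → ψu≢ψv (ι-inj (trans (factors u) (trans e (sym (factors v)))))

→s-avoiding : ∀ {G : MixedGraph m n} (H : MixedGraph m n) {φ} → IsSimpleHom G H φ →
              (w : Fin (size H)) → (∀ y → φ y ≢ w) →
              Σ[ H′ ∈ MixedGraph m n ] suc (size H′) ≡ size H × G →s H′
→s-avoiding {G = G} H@record { size = suc k } {φ} hom w misses =
  induced H (punchIn w) , refl , ψ ,
  →s-corestrict {G = G} {H} (punchIn w) (punchIn-injective w _ _) ψ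
                (λ y → punchIn-punchOut (≢-sym (misses y))) hom
  where
  ψ : Fin (size G) → Fin k
  ψ y = punchOut (≢-sym (misses y))

module Contraction (G : MixedGraph m n) {C : Subset (size G)} (convex : IsConvex G C)
                   {u : Fin (size G)} (u∈C : u ∈ C) where

  -- The adjacency shared by all neighbours of b in C (by convexity), or none.
  towards : Fin (size G) → Adj m n
  towards b with any? (λ c → c ∈? C ×-dec ¬? (adj G c b ≟ᴬ none))
  ... | yes (c , _) = adj G c b
  ... | no _        = none

  towards-agrees : ∀ {b c} → b ∉ C → c ∈ C → adj G c b ≢ none → towards b ≡ adj G c b
  towards-agrees {b} {c} b∉C c∈C cb with any? (λ c → c ∈? C ×-dec ¬? (adj G c b ≟ᴬ none))
  ... | yes (c′ , c′∈C , c′b) = convex⇒agree G convex c′∈C c∈C b∉C c′b cb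
  ... | no nobody             = ⊥-elim (nobody (c , c∈C , cb))

  contractedAdj : Fin (size G) → Fin (size G) → Adj m n
  contractedAdj a b with a ∈? C | b ∈? C
  ... | no _  | no _  = adj G a b
  ... | yes _ | no _  = towards b
  ... | no _  | yes _ = rev (towards a)
  ... | yes _ | yes _ = none

  contracted : MixedGraph m n
  contracted = record
    { size = size G ; adj = contractedAdj ; loopless = loopless′ ; adj-sym = sym′ }
    where
    loopless′ : ∀ a → contractedAdj a a ≡ none
    loopless′ a with a ∈? C
    ... | no _  = loopless G a
    ... | yes _ = refl

    sym′ : ∀ a b → contractedAdj b a ≡ rev (contractedAdj a b)
    sym′ a b with a ∈? C | b ∈? C
    ... | no _  | no _  = adj-sym G a b
    ... | yes _ | no _  = refl
    ... | no _  | yes _ = sym (rev-involutive (towards a))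
    ... | yes _ | yes _ = refl

  contractedAdj-outside : ∀ {a b} → a ∉ C → b ∉ C → contractedAdj a b ≡ adj G a b
  contractedAdj-outside {a} {b} a∉C b∉C with a ∈? C | b ∈? C
  ... | no _   | no _   = refl
  ... | yes a∈ | _      = ⊥-elim (a∉C a∈)
  ... | no _   | yes b∈ = ⊥-elim (b∉C b∈)

  contractedAdj-across : ∀ {a b} → a ∈ C → b ∉ C → contractedAdj a b ≡ towards b
  contractedAdj-across {a} {b} a∈C b∉C with a ∈? C | b ∈? C
  ... | yes _  | no _   = refl
  ... | no a∉  | _      = ⊥-elim (a∉ a∈C)
  ... | yes _  | yes b∈ = ⊥-elim (b∉C b∈)

  collapse : Fin (size G) → Fin (size G)
  collapse y with y ∈? C
  ... | yes _ = u
  ... | no _  = y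

  collapse-preserves : PreservesAdjacencies G contracted collapse
  collapse-preserves a b ab collapsed with a ∈? C | b ∈? C
  ... | yes _   | yes _   = ⊥-elim (collapsed refl)
  ... | no a∉C  | no b∉C  = contractedAdj-outside a∉C b∉C
  ... | yes a∈C | no b∉C  = trans (contractedAdj-across u∈C b∉C) (towards-agrees b∉C a∈C ab)
  ... | no a∉C  | yes b∈C = begin
    contractedAdj a u       ≡⟨ adj-sym contracted u a ⟩
    rev (contractedAdj u a) ≡⟨ cong rev (contractedAdj-across u∈C a∉C) ⟩
    rev (towards a)         ≡⟨ cong rev (towards-agrees a∉C b∈C (adjacent-sym G a b ab)) ⟩
    rev (adj G b a)         ≡⟨ adj-sym G b a ⟨
    adj G a b               ∎
    where open ≡-Reasoning

  collapse-inside : ∀ {y} → y ∈ C → collapse y ≡ u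
  collapse-inside {y} y∈C with y ∈? C
  ... | yes _ = refl
  ... | no y∉ = ⊥-elim (y∉ y∈C)

  collapse-outside : ∀ {y} → y ∉ C → collapse y ≡ y
  collapse-outside {y} y∉C with y ∈? C
  ... | yes y∈ = ⊥-elim (y∉C y∈)
  ... | no _   = refl

  collapse-misses : ∀ {v} → v ∈ C → v ≢ u → ∀ y → collapse y ≢ v
  collapse-misses {v} v∈C v≢u y with y ∈? C
  ... | yes _  = ≢-sym v≢u
  ... | no y∉C = λ y≡v → y∉C (subst (_∈ C) (sym y≡v) v∈C)

  collapse-→s : ∀ {x} → x ∉ C → IsSimpleHom G contracted collapse
  collapse-→s {x} x∉C = inj₂ ((u , x , separated) , collapse-preserves)
    where
    separated : collapse u ≢ collapse x
    separated e =
      x∉C (subst (_∈ C) (trans (sym (collapse-inside u∈C)) (trans e (collapse-outside x∉C))) u∈C)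

fibre : ∀ {k l} → (Fin k → Fin l) → Fin l → Subset k
fibre f t = tabulate (λ y → does (f y ≟ t))

∈-fibre⁺ : ∀ {k l} {f : Fin k → Fin l} {t y} → f y ≡ t → y ∈ fibre f t
∈-fibre⁺ {f = f} {t} {y} fy≡t =
  lookup⇒[]= y _ (trans (lookup∘tabulate _ y) (dec-true (f y ≟ t) fy≡t))

∈-fibre⁻ : ∀ {k l} {f : Fin k → Fin l} {t y} → y ∈ fibre f t → f y ≡ t
∈-fibre⁻ {f = f} {t} {y} y∈ with f y ≟ t | trans (sym (lookup∘tabulate _ y)) ([]=⇒lookup y∈)
... | yes fy≡t | _ = fy≡t
... | no _     | ()

pair⊆ : ∀ {k} {a b : Fin k} {p : Subset k} → a ∈ p → b ∈ p → ⁅ a ⁆ ∪ ⁅ b ⁆ ⊆ p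
pair⊆ {a = a} {b} a∈p b∈p x∈ with x∈p∪q⁻ ⁅ a ⁆ ⁅ b ⁆ x∈
... | inj₁ x∈⁅a⁆ rewrite x∈⁅y⁆⇒x≡y a x∈⁅a⁆ = a∈p
... | inj₂ x∈⁅b⁆ rewrite x∈⁅y⁆⇒x≡y b x∈⁅b⁆ = b∈p

fibre-convex : ∀ {G H : MixedGraph m n} {φ} → PreservesAdjacencies G H φ →
               ∀ t → IsConvex G (fibre φ t)
fibre-convex {G = G} {H} {φ} preserves t p q y p∈ q∈ y∉ (py , qy , between) = between (begin
  adj G p y         ≡⟨ preserves p y py (separated p∈) ⟨
  adj H (φ p) (φ y) ≡⟨ cong (λ s → adj H s (φ y)) (trans (in-fibre p∈) (sym (in-fibre q∈))) ⟩
  adj H (φ q) (φ y) ≡⟨ preserves q y qy (separated q∈) ⟩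
  adj G q y         ∎)
  where
  open ≡-Reasoning
  in-fibre : ∀ {z} → z ∈ fibre φ t → φ z ≡ t
  in-fibre = ∈-fibre⁻ {f = φ}
  separated : ∀ {z} → z ∈ fibre φ t → φ z ≢ φ y
  separated z∈ φz≡φy = y∉ (∈-fibre⁺ {f = φ} (trans (sym φz≡φy) (in-fibre z∈)))

ConvPairsFull : MixedGraph m n → Set
ConvPairsFull G = ∀ u v → u ≢ v → ConvPairFull G u v

simpleClique⇒→s-misses-nothing : ∀ {G H : MixedGraph m n} {φ} → IsSimpleClique G →
                                  IsSimpleHom G H φ → size H ≡ size G →
                                  ∀ w → ¬ (∀ y → φ y ≢ w)
simpleClique⇒→s-misses-nothing {G = G} {H} (_ , minimal) hom same-size w misses
  with →s-avoiding {G = G} H hom w misses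
... | H′ , shrinks , hom′ =
  <-irrefl refl (subst (_≤ size H′) (trans (sym same-size) (sym shrinks)) (minimal H′ hom′))

simpleClique⇒convPairsFull : (G : MixedGraph m n) → IsSimpleClique G → ConvPairsFull G
simpleClique⇒convPairsFull G clique u v u≢v x C convex pair⊆C with x ∈? C
... | yes x∈C = x∈C
... | no x∉C  = ⊥-elim (simpleClique⇒→s-misses-nothing {G = G} {contracted} clique
                          (collapse-→s x∉C) refl v (collapse-misses v∈C (≢-sym u≢v)))
  where
  u∈C = pair⊆C (x∈p∪q⁺ (inj₁ (x∈⁅x⁆ u)))
  v∈C = pair⊆C (x∈p∪q⁺ (inj₂ (x∈⁅x⁆ v)))
  open Contraction G convex u∈C

≡1⇒Fin-unique : ∀ {k} → k ≡ 1 → (a b : Fin k) → a ≡ b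
≡1⇒Fin-unique refl zero zero = refl

convPairsFull⇒→s-injective : ∀ {G H : MixedGraph m n} {φ} → ConvPairsFull G →
                             IsSimpleHom G H φ → Injective _≡_ _≡_ φ
convPairsFull⇒→s-injective full (inj₁ single) {a} {b} _ = ≡1⇒Fin-unique single a b
convPairsFull⇒→s-injective {G = G} {H} {φ} full (inj₂ ((c , d , φc≢φd) , preserves))
                           {a} {b} φa≡φb with a ≟ b
... | yes a≡b = a≡b
... | no a≢b  = ⊥-elim (φc≢φd (trans (constant c) (sym (constant d))))
  where
  constant : ∀ y → φ y ≡ φ a
  constant y = ∈-fibre⁻ {f = φ} (full a b a≢b y _ (fibre-convex {G = G} {H} preserves (φ a))
                 (pair⊆ (∈-fibre⁺ {f = φ} refl) (∈-fibre⁺ {f = φ} (sym φa≡φb))))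

one⊎twoDistinct : ∀ {k} → NonZero k → k ≡ 1 ⊎ Σ[ a ∈ Fin k ] Σ[ b ∈ Fin k ] a ≢ b
one⊎twoDistinct {suc zero}    _ = inj₁ refl
one⊎twoDistinct {suc (suc _)} _ = inj₂ (zero , suc zero , λ ())

id-→s : (G : MixedGraph m n) → NonZero (size G) → G →s G
id-→s G nonempty with one⊎twoDistinct nonempty
... | inj₁ single          = (λ y → y) , inj₁ single
... | inj₂ (a , b , a≢b)   = (λ y → y) , inj₂ ((a , b , a≢b) , λ _ _ _ _ → refl)

convPairsFull⇒simpleClique : (G : MixedGraph m n) → NonZero (size G) →
                             ConvPairsFull G → IsSimpleClique G
convPairsFull⇒simpleClique G nonempty full =
  (G , refl , id-→s G nonempty) ,
  λ H (φ , hom) → injective⇒≤ (convPairsFull⇒→s-injective {G = G} {H} full hom)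

mainTheorem11 : ∀ {m n : ℕ} (G : MixedGraph m n) → NonZero (size G) →
    (IsSimpleClique G → ∀ u v → u ≢ v → ConvPairFull G u v)
    × ((∀ u v → u ≢ v → ConvPairFull G u v) → IsSimpleClique G)
mainTheorem11 G nonempty = simpleClique⇒convPairsFull G , convPairsFull⇒simpleClique G nonempty
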